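{- Let $m=2n$. Consider a deck of $m$ cards labeled $1,\dots,m$ from top to bottom, and the following random procedure. Step 1: choose $j\in\{0,1,\dots,n\}$ with probability $\binom{2n}{2j}/2^{2n-1}$; form a second pile of size $2j$ by removing the top $j$ cards of the deck and then putting the bottom $j$ cards of the deck (in their order) on top of them; the remaining $2n-2j$ middle cards form the first pile. Step 2: choose uniformly at random one of the $\binom{2n}{2j}$ interleavings of the two piles preserving the relative order within each pile. Encode the resulting deck as $\sigma\in S_m$ where $\sigma(i)$ is the label of the card in position $i$. Then for every $\sigma\in S_m$ the probability that the procedure yields $\sigma$ equals $x_2(\sigma^{ -1})$. The same holds for $m=2n+1$, with $j\in\{0,\dots,n\}$ chosen with probability $\binom{2n+1}{2j}/2^{2n}$ and the first pile having $2n+1-2j$ cards.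
   Context: For $w\in S_m$, $x_2(w)$ is $2^{ -(m-1)}$ times the number of integer vectors $(v_1,\dots,v_m)$ with $v_1+\dots+v_m=0$, $v_1\ge\dots\ge v_m$, $v_1-v_m\le 2$, $v_i>v_{i+1}$ whenever $w(i)>w(i+1)$ ($1\le i\le m-1$), and $v_1<v_m+2$ if $w(m)>w(1)$ (the type $A_{m-1}$ affine $2$-shuffle). -}

module Defs where

open import Data.Bool using (Bool; true; false; _∧_; not; if_then_else_)
open import Data.Nat as ℕ using (ℕ; zero; suc; _∸_; _^_)
open import Data.Nat.Combinatorics using (_C_)
open import Data.Fin using (Fin; toℕ)
open import Data.Integer as ℤ using (ℤ; +_; -[1+_])
open import Data.Rational as ℚ using (ℚ; 0ℚ)
open import Data.List using (List; []; _∷_; map; upTo; allFin; _++_; length; filterᵇ; concatMap; zip; drop; sum; foldr; last; head)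
open import Data.List.Properties using (≡-dec)
open import Data.Maybe using (Maybe; just; nothing)
open import Data.Product using (_×_; _,_)
open import Relation.Nullary using (does)
open import Relation.Nullary.Decidable using (⌊_⌋)
open import Data.Fin.Permutation using (Permutation′; _⟨$⟩ʳ_; flip)

-- a /' d = a/d as a rational number (d is always nonzero where used;
-- the value 0 at d = 0 is a harmless convention).
_/'_ : ℕ → ℕ → ℚ
a /' zero  = 0ℚ
a /' suc d = (+ a) ℚ./ suc d

sumℚ≤ : ℕ → (ℕ → ℚ) → ℚ
sumℚ≤ n f = foldr (λ j acc → f j ℚ.+ acc) 0ℚ (upTo (suc n))

interval : ℕ → ℕ → List ℕ
interval a len = map (a ℕ.+_) (upTo len)

boolLists : ℕ → List (List Bool)
boolLists zero    = [] ∷ []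
boolLists (suc k) = concatMap (λ b → map (b ∷_) (boolLists k)) (true ∷ false ∷ [])

countTrue : List Bool → ℕ
countTrue [] = 0
countTrue (true ∷ s)  = suc (countTrue s)
countTrue (false ∷ s) = countTrue s

consec : {A : Set} → List A → List (A × A)
consec xs = zip xs (drop 1 xs)

allB : List Bool → Bool
allB = foldr _∧_ true

-- The shuffling procedure.  Cards are labelled 1..m (top to bottom).
-- A deck (top to bottom) is a list of labels.

-- Deck encoded by σ : position i (0-based) holds card σ(i), label σ(i)+1.
deckOf : {m : ℕ} → Permutation′ m → List ℕ
deckOf {m} σ = map (λ i → suc (toℕ (σ ⟨$⟩ʳ i))) (allFin m)

pile2 : ℕ → ℕ → List ℕ
pile2 m j = interval (suc (m ∸ j)) j ++ interval 1 j

pile1 : ℕ → ℕ → List ℕ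
pile1 m j = interval (suc j) (m ∸ (2 ℕ.* j))

-- Interleaving of two piles determined by the set of positions (true)
-- that receive the cards of the second pile, preserving order in each.
merge : List Bool → List ℕ → List ℕ → List ℕ
merge [] _ _ = []
merge (true ∷ s) a (y ∷ b) = y ∷ merge s a b
merge (true ∷ s) a [] = []
merge (false ∷ s) (x ∷ a) b = x ∷ merge s a b
merge (false ∷ s) [] b = []

interleavingsGiving : {m : ℕ} → ℕ → Permutation′ m → ℕ
interleavingsGiving {m} j σ =
  length (filterᵇ (λ s → ⌊ countTrue s ℕ.≟ 2 ℕ.* j ⌋ ∧
                        ⌊ ≡-dec ℕ._≟_ (merge s (pile1 m j) (pile2 m j)) (deckOf σ) ⌋)
                 (boolLists m))

shuffleProb : (m n : ℕ) → Permutation′ m → ℚ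
shuffleProb m n σ =
  sumℚ≤ n (λ j → ((m C (2 ℕ.* j)) /' (2 ^ (m ∸ 1)))
                 ℚ.* (interleavingsGiving j σ /' (m C (2 ℕ.* j))))

smallVecs : ℕ → List (List ℤ)
smallVecs zero    = [] ∷ []
smallVecs (suc k) =
  concatMap (λ x → map (x ∷_) (smallVecs k))
            (-[1+ 1 ] ∷ -[1+ 0 ] ∷ + 0 ∷ + 1 ∷ + 2 ∷ [])

sumℤ : List ℤ → ℤ
sumℤ = foldr ℤ._+_ (+ 0)

infix 4 _≤ᵇ_ _<ᵇ_ _<ℕᵇ_
_≤ᵇ_ : ℤ → ℤ → Bool
x ≤ᵇ y = ⌊ x ℤ.≤? y ⌋

_<ᵇ_ : ℤ → ℤ → Bool
x <ᵇ y = ⌊ x ℤ.<? y ⌋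

_<ℕᵇ_ : ℕ → ℕ → Bool
x <ℕᵇ y = ⌊ x ℕ.<? y ⌋

endConds : List ℕ → List ℤ → Bool
endConds w v with head v | last v | head w | last w
... | just v₁ | just vₘ | just w₁ | just wₘ =
      ((v₁ ℤ.- vₘ) ≤ᵇ (+ 2))
    ∧ (if w₁ <ℕᵇ wₘ then v₁ <ᵇ (vₘ ℤ.+ (+ 2)) else true)
... | _ | _ | _ | _ = false

admissible : List ℕ → List ℤ → Bool
admissible w v =
    ⌊ sumℤ v ℤ.≟ + 0 ⌋
  ∧ allB (map (λ p → Data.Product.proj₂ p ≤ᵇ Data.Product.proj₁ p) (consec v))
  ∧ endConds w v
  ∧ allB (map (λ q → if Data.Product.proj₂ (Data.Product.proj₁ q) <ℕᵇ Data.Product.proj₁ (Data.Product.proj₁ q)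
                     then Data.Product.proj₂ (Data.Product.proj₂ q) <ᵇ Data.Product.proj₁ (Data.Product.proj₂ q)
                     else true)
              (zip (consec w) (consec v)))
  where import Data.Product

valuesOf : {m : ℕ} → Permutation′ m → List ℕ
valuesOf {m} w = map (λ i → toℕ (w ⟨$⟩ʳ i)) (allFin m)

-- number of admissible integer vectors (all such vectors lie in
-- {-2..2}^m since v_m ≤ 0 ≤ v_1 and v_1 - v_m ≤ 2)
x2Count : {m : ℕ} → Permutation′ m → ℕ
x2Count {m} w = length (filterᵇ (λ v → admissible (valuesOf w) v) (smallVecs m))

x₂ : {m : ℕ} → Permutation′ m → ℚ
x₂ {m} w = x2Count w /' (2 ^ (m ∸ 1))

inv : {m : ℕ} → Permutation′ m → Permutation′ m
inv = flip

-- Write w = σ⁻¹. A non-increasing integer vector with zero sum and v₁ - vₘ ≤ 2 has all entries in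
-- {-1, 0, 1}, so the vectors counted by x₂(w) are among the staircases v = (1^j, 0^(m-2j), (-1)^j).
-- Cutting w into the blocks X, Y, Z (lengths j, m-2j, j) on which such a v is constant, v is admissible
-- for w exactly when w increases along Z ++ X and along Y.
-- For the same j, the positions in the deck σ of the second pile (bottom j cards, then top j cards)
-- are the entries of Z ++ X, and those of the first pile are the entries of Y. A word s merges the two
-- piles into σ only if s marks the second-pile cards of σ, and that s works exactly when both lists of
-- positions increase. Hence interleavingsGiving j σ is 1 or 0 according as the staircase is admissible,
-- and the weights C(m,2j)/2^(m-1) cancel to give x₂(w).
module Submission where

open import Defs
open import Data.Bool using (Bool; true; false; T; not; _∧_; _∨_; if_then_else_)
open import Data.Bool.Properties using (T-≡; T-∧; T-∨; T-not-≡)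
open import Data.Empty using (⊥-elim)
open import Data.Fin using (Fin; toℕ; fromℕ<)
open import Data.Fin.Properties using (toℕ<n; fromℕ<-toℕ; toℕ-fromℕ<; toℕ-injective)
open import Data.Fin.Permutation using (Permutation′; _⟨$⟩ʳ_; _⟨$⟩ˡ_; inverseˡ; inverseʳ)
open import Data.Integer as ℤ using (ℤ; +_; -[1+_])
import Data.Integer.Properties as ℤ
import Data.Integer.Solver
open import Data.List
  using (List; []; _∷_; [_]; _++_; map; length; filterᵇ; foldr; head; last; replicate;
         applyUpTo; upTo; tabulate; allFin; zip; cartesianProductWith)
open import Data.List.Properties
  using (≡-dec; ∷-injective; ++-assoc; ++-identityʳ; map-++; map-∘; map-applyUpTo; map-tabulate;
         map-cong-local; filter-accept; filter-reject; length-map; length-++; length-replicate;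
         length-applyUpTo; length-upTo; length-tabulate)
open import Data.List.Membership.Propositional using (_∈_)
open import Data.List.Membership.Propositional.Properties
  using (∈-map⁺; ∈-map⁻; ∈-filter⁺; ∈-filter⁻; ∈-++⁺ˡ; ∈-++⁺ʳ; ∈-++⁻; ∈-allFin;
         ∈-upTo⁺; ∈-upTo⁻; ∈-cartesianProductWith⁺; ∈-cartesianProductWith⁻)
open import Data.List.Membership.Propositional.Properties.WithK using (unique∧set⇒bag)
open import Data.List.Relation.Binary.BagAndSetEquality using (∼bag⇒↭)
open import Data.List.Relation.Binary.Disjoint.Propositional using (Disjoint)
open import Data.List.Relation.Binary.Permutation.Propositional.Properties using (↭-length)
open import Data.List.Relation.Unary.All using (All; []; _∷_)
import Data.List.Relation.Unary.All as All
import Data.List.Relation.Unary.All.Properties as All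
open import Data.List.Relation.Unary.AllPairs using (AllPairs; []; _∷_)
import Data.List.Relation.Unary.AllPairs.Properties as AllPairs
open import Data.List.Relation.Unary.Any using (here; there)
open import Data.List.Relation.Unary.Linked using (Linked; []; [-]; _∷_; _∷′_)
import Data.List.Relation.Unary.Linked as Linked
import Data.List.Relation.Unary.Linked.Properties as Linked
open import Data.List.Relation.Unary.Unique.Propositional using (Unique)
import Data.List.Relation.Unary.Unique.Propositional.Properties as Unique
open import Data.Maybe using (just; nothing)
open import Data.Maybe.Relation.Binary.Connected using (Connected; just; just-nothing; nothing-just; nothing)
open import Data.Nat using (ℕ; zero; suc; pred; _+_; _*_; _∸_; _^_; _≤_; _<_; _≤?_; _<?_; _≟_; z≤n; s≤s)
import Data.Nat.Properties as ℕ
open import Data.Nat.Combinatorics using (_C_; nCk+nC[k+1]≡[n+1]C[k+1])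
import Data.Nat.Solver
open import Data.Nat.ListAction using (sum)
open import Data.Product using (_×_; _,_; proj₁; proj₂; ∃-syntax)
open import Data.Product.Function.NonDependent.Propositional using (_×-⇔_)
open import Data.Rational as ℚ using (ℚ; 0ℚ; toℚᵘ)
import Data.Rational.Properties as ℚ
open import Data.Rational.Unnormalised as ℚᵘ using (mkℚᵘ; *≡*)
import Data.Rational.Unnormalised.Properties as ℚᵘ
open import Data.Sum using (_⊎_; inj₁; inj₂)
import Data.Sum as Sum
open import Data.Unit using (tt)
open import Function using (_∘_; _on_)
open import Function.Bundles using (_⇔_; mk⇔; Equivalence)
open import Function.Properties.Equivalence using (⇔-setoid)
import Function.Properties.Equivalence as ⇔
open import Level using (0ℓ)
open import Relation.Binary.Definitions using (Asymmetric)
import Relation.Binary.Reasoning.Setoid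
open import Relation.Nullary using (¬_; Dec; yes; no)
open import Relation.Nullary.Decidable using (⌊_⌋; T?; toWitness; fromWitness)
open import Relation.Binary.PropositionalEquality
  using (_≡_; _≢_; refl; sym; trans; cong; cong₂; subst; subst₂; module ≡-Reasoning)

module ⇔-Reasoning = Relation.Binary.Reasoning.Setoid (⇔-setoid 0ℓ)
module ℕ-Solver = Data.Nat.Solver.+-*-Solver
module ℤ-Solver = Data.Integer.Solver.+-*-Solver

T-⌊⌋ : {P : Set} (d : Dec P) → T ⌊ d ⌋ ⇔ P
T-⌊⌋ d = mk⇔ toWitness fromWitness

T-not : ∀ {b} → T (not b) ⇔ (¬ T b)
T-not {true}  = mk⇔ (λ ()) (λ ¬t → ¬t _)
T-not {false} = mk⇔ (λ _ ()) _

T-injective : ∀ {a b} → T a ⇔ T b → a ≡ b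
T-injective {true}  {true}  _   = refl
T-injective {true}  {false} a⇔b = ⊥-elim (Equivalence.to a⇔b _)
T-injective {false} {true}  a⇔b = ⊥-elim (Equivalence.from a⇔b _)
T-injective {false} {false} _   = refl

T-if-true : ∀ b {x} → T x → T (if b then x else true)
T-if-true true  x = x
T-if-true false _ = tt

inhabited-×⇔ : {P Q : Set} → P → (P × Q) ⇔ Q
inhabited-×⇔ p = mk⇔ proj₂ (p ,_)

indicator : Bool → ℕ
indicator true  = 1
indicator false = 0

count : {A : Set} → (A → Bool) → List A → ℕ
count P xs = length (filterᵇ P xs)

count-[x] : {A : Set} (P : A → Bool) (x : A) → count P [ x ] ≡ indicator (P x)
count-[x] P x with P x
... | true  = refl
... | false = refl

count-map : {A B : Set} (P : B → Bool) (f : A → B) (xs : List A) → count P (map f xs) ≡ count (P ∘ f) xs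
count-map P f []       = refl
count-map P f (x ∷ xs) with P (f x)
... | true  = cong suc (count-map P f xs)
... | false = count-map P f xs

sum-indicator : {A : Set} (P : A → Bool) (xs : List A) → sum (map (indicator ∘ P) xs) ≡ count P xs
sum-indicator P []       = refl
sum-indicator P (x ∷ xs) with P x
... | true  = cong suc (sum-indicator P xs)
... | false = sum-indicator P xs

count-cong-Unique : {A : Set} (P : A → Bool) {xs ys : List A} → Unique xs → Unique ys →
                    (∀ {x} → T (P x) → x ∈ xs ⇔ x ∈ ys) → count P xs ≡ count P ys
count-cong-Unique P {xs} {ys} xs! ys! same = ↭-length (∼bag⇒↭ (unique∧set⇒bag
  (Unique.filter⁺ (T? ∘ P) xs!) (Unique.filter⁺ (T? ∘ P) ys!)
  (mk⇔ (keep (Equivalence.to ∘ same)) (keep (Equivalence.from ∘ same)))))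
  where
  keep : ∀ {zs ws} → (∀ {x} → T (P x) → x ∈ zs → x ∈ ws) →
         ∀ {x} → x ∈ filterᵇ P zs → x ∈ filterᵇ P ws
  keep ⊆ x∈ = let (x∈zs , Px) = ∈-filter⁻ (T? ∘ P) x∈ in ∈-filter⁺ (T? ∘ P) (⊆ Px x∈zs) Px

module _ {A : Set} {R : A → A → Set} (R-asym : Asymmetric R) where

  AllPairs-≡ : ∀ {xs ys} → AllPairs R xs → AllPairs R ys → (∀ {z} → z ∈ xs ⇔ z ∈ ys) → xs ≡ ys
  AllPairs-≡ {[]}     {[]}     _ _ _ = refl
  AllPairs-≡ {[]}     {_ ∷ _}  _ _ same with () ← Equivalence.from same (here refl)
  AllPairs-≡ {_ ∷ _}  {[]}     _ _ same with () ← Equivalence.to same (here refl)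
  AllPairs-≡ {x ∷ xs} {y ∷ ys} (x< ∷ <xs) (y< ∷ <ys) same with Equivalence.to same (here refl)
  ... | here refl =
    cong (x ∷_) (AllPairs-≡ <xs <ys (mk⇔ (tail x< (Equivalence.to same)) (tail y< (Equivalence.from same))))
    where
    tail : ∀ {zs ws} → All (R x) zs → (∀ {z} → z ∈ x ∷ zs → z ∈ x ∷ ws) →
           ∀ {z} → z ∈ zs → z ∈ ws
    tail x<zs ⊆ z∈ with ⊆ (there z∈)
    ... | here refl  = ⊥-elim (R-asym x<x x<x) where x<x = All.lookup x<zs z∈
    ... | there z∈ws = z∈ws
  ... | there x∈ys with Equivalence.from same (here refl)
  ...   | here refl  = ⊥-elim (R-asym y<y y<y) where y<y = All.lookup y< x∈ys
  ...   | there y∈xs = ⊥-elim (R-asym (All.lookup x< y∈xs) (All.lookup y< x∈ys))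

  filterᵇ-≡⇔AllPairs : (p : A → Bool) {D B : List A} → AllPairs R D →
                       (∀ {x} → x ∈ B ⇔ (x ∈ D × T (p x))) → filterᵇ p D ≡ B ⇔ AllPairs R B
  filterᵇ-≡⇔AllPairs p <D ∈B = mk⇔
    (λ { refl → AllPairs.filter⁺ (T? ∘ p) <D })
    (λ <B → AllPairs-≡ (AllPairs.filter⁺ (T? ∘ p) <D) <B (mk⇔
      (λ x∈ → Equivalence.from ∈B (∈-filter⁻ (T? ∘ p) x∈))
      (λ x∈ → let (x∈D , px) = Equivalence.to ∈B x∈ in ∈-filter⁺ (T? ∘ p) x∈D px)))

Unique-++⁻ : {A : Set} (xs : List A) {ys : List A} → Unique (xs ++ ys) → Unique xs × Unique ys × Disjoint xs ys
Unique-++⁻ []       u = [] , u , λ { (() , _) }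
Unique-++⁻ (x ∷ xs) (x∉ ∷ u) with u₁ , u₂ , disj ← Unique-++⁻ xs u =
  All.++⁻ˡ xs x∉ ∷ u₁ , u₂ , λ { (here refl , x∈ys) → All.lookup (All.++⁻ʳ xs x∉) x∈ys refl
                               ; (there v∈xs , v∈ys) → disj (v∈xs , v∈ys) }

Unique-++-comm : {A : Set} (xs : List A) {ys : List A} → Unique (xs ++ ys) → Unique (ys ++ xs)
Unique-++-comm xs u with u₁ , u₂ , disj ← Unique-++⁻ xs u =
  Unique.++⁺ u₂ u₁ (λ (v∈ys , v∈xs) → disj (v∈xs , v∈ys))

Unique-rotate : {A : Set} (X Y Z : List A) → Unique (X ++ Y ++ Z) → Unique (Z ++ X) × Unique Y
Unique-rotate X Y Z u with uY , uZX , _ ← Unique-++⁻ Y (subst Unique (++-assoc Y Z X) (Unique-++-comm X u)) =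
  uZX , uY

Linked-≤⇒< : ∀ {xs} → Unique xs → Linked _≤_ xs → Linked _<_ xs
Linked-≤⇒< u l = Linked.zipWith (λ (m≤n , m≢n) → ℕ.≤∧≢⇒< m≤n m≢n) (l , Linked.AllPairs⇒Linked u)

Linked-<-map⇔ : {A : Set} (f : A → ℕ) {xs : List A} → Linked _<_ (map f xs) ⇔ AllPairs (_<_ on f) xs
Linked-<-map⇔ f =
  mk⇔ (AllPairs.map⁻ ∘ Linked.Linked⇒AllPairs ℕ.<-trans) (Linked.AllPairs⇒Linked ∘ AllPairs.map⁺)

Linked-∷⇔ : {A : Set} {R : A → A → Set} {x y : A} {xs : List A} →
            (R x y × Linked R (y ∷ xs)) ⇔ Linked R (x ∷ y ∷ xs)
Linked-∷⇔ = mk⇔ (λ (r , l) → r ∷ l) (λ { (r ∷ l) → r , l })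

Linked-++⁻ : {A : Set} {R : A → A → Set} (xs : List A) {ys : List A} → Linked R (xs ++ ys) →
             Linked R xs × Connected R (last xs) (head ys) × Linked R ys
Linked-++⁻ []            {[]}    l       = [] , nothing , l
Linked-++⁻ []            {_ ∷ _} l       = [] , nothing-just , l
Linked-++⁻ (x ∷ [])      {[]}    l       = [-] , just-nothing , []
Linked-++⁻ (x ∷ [])      {_ ∷ _} (r ∷ l) = [-] , just r , l
Linked-++⁻ (x ∷ x′ ∷ xs)         (r ∷ l) with l₁ , c , l₂ ← Linked-++⁻ (x′ ∷ xs) l =
  r ∷ l₁ , c , l₂

All⇒Connected : {A : Set} {R : A → A → Set} {x : A} {ys : List A} →
                All (R x) ys → Connected R (just x) (head ys)
All⇒Connected []      = just-nothing
All⇒Connected (r ∷ _) = just r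

Connected-just⇔ : {A : Set} {R : A → A → Set} {x y : A} → Connected R (just x) (just y) ⇔ R x y
Connected-just⇔ = mk⇔ (λ { (just r) → r }) just

last-∷ : {A : Set} (y : A) (ys : List A) → ∃[ z ] last (y ∷ ys) ≡ just z
last-∷ y []        = y , refl
last-∷ y (y′ ∷ ys) = last-∷ y′ ys

last-++-∷ : {A : Set} (xs : List A) (y : A) (ys : List A) → last (xs ++ y ∷ ys) ≡ last (y ∷ ys)
last-++-∷ []            y ys = refl
last-++-∷ (x ∷ [])      y ys = refl
last-++-∷ (x ∷ x′ ∷ xs) y ys = last-++-∷ (x′ ∷ xs) y ys

last-replicate : {A : Set} (n : ℕ) (x : A) → last (replicate (suc n) x) ≡ just x
last-replicate zero    x = refl
last-replicate (suc n) x = last-replicate n x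

applyUpTo-++ : {A : Set} (f : ℕ → A) (b c : ℕ) →
               applyUpTo f (b + c) ≡ applyUpTo f b ++ applyUpTo (λ i → f (b + i)) c
applyUpTo-++ f zero    c = refl
applyUpTo-++ f (suc b) c = cong (f 0 ∷_) (applyUpTo-++ (f ∘ suc) b c)

tabulate≡applyUpTo : {A : Set} {n : ℕ} {f : Fin n → A} {g : ℕ → A} →
                     (∀ i → f i ≡ g (toℕ i)) → tabulate f ≡ applyUpTo g n
tabulate≡applyUpTo {n = zero}  f≗g = refl
tabulate≡applyUpTo {n = suc n} f≗g = cong₂ _∷_ (f≗g Fin.zero) (tabulate≡applyUpTo (f≗g ∘ Fin.suc))
  where import Data.Fin as Fin

map-interval : {A : Set} (f : ℕ → A) (a l : ℕ) → map f (interval a l) ≡ applyUpTo (λ i → f (a + i)) l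
map-interval f a l = trans (sym (map-∘ (upTo l))) (map-applyUpTo (λ i → i) (λ i → f (a + i)) l)

length-interval : ∀ a l → length (interval a l) ≡ l
length-interval a l = trans (length-map (_+_ a) (upTo l)) (length-upTo l)

∈-interval : ∀ {x} a l → x ∈ interval a l ⇔ (a ≤ x × x < a + l)
∈-interval {x} a l = mk⇔
  (λ x∈ → let (i , i∈ , x≡) = ∈-map⁻ (_+_ a) x∈ in
          subst (λ y → a ≤ y × y < a + l) (sym x≡) (ℕ.m≤m+n a i , ℕ.+-monoʳ-< a (∈-upTo⁻ i∈)))
  (λ (a≤x , x<a+l) → subst (_∈ interval a l) (ℕ.m+[n∸m]≡n a≤x) (∈-map⁺ (_+_ a) (∈-upTo⁺
          (ℕ.+-cancelˡ-< a _ _ (subst (_< a + l) (sym (ℕ.m+[n∸m]≡n a≤x)) x<a+l)))))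

words : {A : Set} → List A → ℕ → List (List A)
words Σ zero    = [ [] ]
words Σ (suc k) = cartesianProductWith _∷_ Σ (words Σ k)

∈-words⁻ : {A : Set} (Σ : List A) (k : ℕ) {v : List A} → v ∈ words Σ k → length v ≡ k
∈-words⁻ Σ zero    (here refl) = refl
∈-words⁻ Σ (suc k) v∈ with _ , u , _ , u∈ , refl ← ∈-cartesianProductWith⁻ _∷_ Σ (words Σ k) v∈ =
  cong suc (∈-words⁻ Σ k u∈)

∈-words⁺ : {A : Set} {Σ : List A} {v : List A} → All (_∈ Σ) v → v ∈ words Σ (length v)
∈-words⁺ []         = here refl
∈-words⁺ (x∈ ∷ v∈) = ∈-cartesianProductWith⁺ _∷_ x∈ (∈-words⁺ v∈)

words-Unique : {A : Set} {Σ : List A} → Unique Σ → ∀ k → Unique (words Σ k)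
words-Unique Σ! zero    = [] ∷ []
words-Unique Σ! (suc k) = Unique.cartesianProductWith⁺ _∷_ ∷-injective Σ! (words-Unique Σ! k)

bools : List Bool
bools = true ∷ false ∷ []

boolLists≡words : ∀ k → boolLists k ≡ words bools k
boolLists≡words zero    = refl
boolLists≡words (suc k) = cong (cartesianProductWith _∷_ bools) (boolLists≡words k)

∈-boolLists⁻ : ∀ {k s} → s ∈ boolLists k → length s ≡ k
∈-boolLists⁻ {k} s∈ = ∈-words⁻ bools k (subst (_ ∈_) (boolLists≡words k) s∈)

∈-boolLists⁺ : ∀ s → s ∈ boolLists (length s)
∈-boolLists⁺ s =
  subst (s ∈_) (sym (boolLists≡words (length s))) (∈-words⁺ (All.tabulate (λ {b} _ → ∈-bools b)))
  where
  ∈-bools : ∀ b → b ∈ bools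
  ∈-bools true  = here refl
  ∈-bools false = there (here refl)

boolLists-Unique : ∀ k → Unique (boolLists k)
boolLists-Unique k = subst Unique (sym (boolLists≡words k)) (words-Unique (((λ ()) ∷ []) ∷ [] ∷ []) k)

-- Interleavings of two piles

countTrue-map : (p : ℕ → Bool) (D : List ℕ) → countTrue (map p D) ≡ length (filterᵇ p D)
countTrue-map p []      = refl
countTrue-map p (d ∷ D) with p d
... | true  = cong suc (countTrue-map p D)
... | false = countTrue-map p D

merge-map-filter : (p : ℕ → Bool) (D : List ℕ) → merge (map p D) (filterᵇ (not ∘ p) D) (filterᵇ p D) ≡ D
merge-map-filter p []      = refl
merge-map-filter p (d ∷ D) with p d
... | true  = cong (d ∷_) (merge-map-filter p D)
... | false = cong (d ∷_) (merge-map-filter p D)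

merge-determined : {p : ℕ → Bool} {A B D : List ℕ} (s : List Bool) →
                   All (T ∘ not ∘ p) A → All (T ∘ p) B → length A + length B ≡ length D →
                   length s ≡ length D → countTrue s ≡ length B → merge s A B ≡ D →
                   s ≡ map p D × filterᵇ p D ≡ B × filterᵇ (not ∘ p) D ≡ A
merge-determined {A = []}    {[]}    []  [] [] _ _ _ refl = refl , refl , refl
merge-determined {A = []}    {_ ∷ _} []  _ _ _ _ () _
merge-determined {A = _ ∷ _}         []  _ _ () _ _ refl
merge-determined {B = []}    (true ∷ s)  _ _ _ () _ refl
merge-determined {A = []}    (false ∷ s) _ _ _ () _ refl
merge-determined {p} {A} {b ∷ B} (true ∷ s) A¬p (pb ∷ Bp) |A|+|B| |s| |s|ᵗ refl
  with s≡ , B≡ , A≡ ← merge-determined s A¬p Bp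
                         (ℕ.suc-injective (trans (sym (ℕ.+-suc (length A) (length B))) |A|+|B|))
                         (ℕ.suc-injective |s|) (ℕ.suc-injective |s|ᵗ) refl =
  cong₂ _∷_ (sym (Equivalence.to T-≡ pb)) s≡ ,
  trans (filter-accept (T? ∘ p) pb) (cong (b ∷_) B≡) ,
  trans (filter-reject (T? ∘ not ∘ p) (λ ¬pb → Equivalence.to T-not ¬pb pb)) A≡
merge-determined {p} {a ∷ A} {B} (false ∷ s) (¬pa ∷ A¬p) Bp |A|+|B| |s| |s|ᵗ refl
  with s≡ , B≡ , A≡ ← merge-determined s A¬p Bp (ℕ.suc-injective |A|+|B|) (ℕ.suc-injective |s|) |s|ᵗ refl =
  cong₂ _∷_ (sym (Equivalence.to T-not-≡ ¬pa)) s≡ ,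
  trans (filter-reject (T? ∘ p) (Equivalence.to T-not ¬pa)) B≡ ,
  trans (filter-accept (T? ∘ not ∘ p) ¬pa) (cong (a ∷_) A≡)

interleavesᵇ : List ℕ → List ℕ → List ℕ → ℕ → List Bool → Bool
interleavesᵇ A B D c s = ⌊ countTrue s ≟ c ⌋ ∧ ⌊ ≡-dec _≟_ (merge s A B) D ⌋

module _ {p : ℕ → Bool} {A B D : List ℕ}
         (A¬p : All (T ∘ not ∘ p) A) (Bp : All (T ∘ p) B) (|A|+|B| : length A + length B ≡ length D) where

  T-interleavesᵇ : ∀ s → length s ≡ length D → T (interleavesᵇ A B D (length B) s) ⇔
                   (s ≡ map p D × filterᵇ p D ≡ B × filterᵇ (not ∘ p) D ≡ A)
  T-interleavesᵇ s |s| = mk⇔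
    (λ h → let (c , m) = Equivalence.to (T-∧ {⌊ count? ⌋}) h in
           merge-determined s A¬p Bp |A|+|B| |s| (toWitness c) (toWitness {a? = merge?} m))
    (λ { (refl , refl , refl) → Equivalence.from T-∧
           (fromWitness (countTrue-map p D) , fromWitness {a? = merge?} (merge-map-filter p D)) })
    where
    count? = countTrue s ≟ length B
    merge? = ≡-dec _≟_ (merge s A B) D

  count-interleavings : ∀ {b} → T b ⇔ (filterᵇ p D ≡ B × filterᵇ (not ∘ p) D ≡ A) →
                        count (interleavesᵇ A B D (length B)) (boolLists (length D)) ≡ indicator b
  count-interleavings {b} b⇔ = begin
    count Q (boolLists (length D)) ≡⟨ count-cong-Unique Q (boolLists-Unique (length D)) ([] ∷ []) only-pD ⟩
    count Q [ map p D ]            ≡⟨ count-[x] Q (map p D) ⟩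
    indicator (Q (map p D))        ≡⟨ cong indicator (T-injective (mk⇔
                                        (λ h → Equivalence.from b⇔ (proj₂ (Equivalence.to Q-pD h)))
                                        (λ hb → Equivalence.from Q-pD (refl , Equivalence.to b⇔ hb)))) ⟩
    indicator b                    ∎
    where
    open ≡-Reasoning
    Q = interleavesᵇ A B D (length B)
    |pD| = length-map p D
    Q-pD = T-interleavesᵇ (map p D) |pD|
    only-pD : ∀ {s} → T (Q s) → s ∈ boolLists (length D) ⇔ s ∈ [ map p D ]
    only-pD {s} Qs = mk⇔
      (λ s∈ → here (proj₁ (Equivalence.to (T-interleavesᵇ s (∈-boolLists⁻ s∈)) Qs)))
      (λ { (here refl) → subst (λ k → map p D ∈ boolLists k) |pD| (∈-boolLists⁺ (map p D)) })

-- The deck and its two piles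

-- The position (from 0) in the deck σ of the card labelled suc c; the value 0 for c ≥ m is junk.
position : {m : ℕ} → Permutation′ m → ℕ → ℕ
position {m} σ c with c <? m
... | yes c<m = toℕ (σ ⟨$⟩ˡ fromℕ< c<m)
... | no  _   = 0

position-toℕ : ∀ {m} (σ : Permutation′ m) i → position σ (toℕ i) ≡ toℕ (σ ⟨$⟩ˡ i)
position-toℕ {m} σ i with toℕ i <? m
... | yes i<m = cong (toℕ ∘ (σ ⟨$⟩ˡ_)) (fromℕ<-toℕ i i<m)
... | no  i≮m = ⊥-elim (i≮m (toℕ<n i))

valuesOf-inv : ∀ {m} (σ : Permutation′ m) → valuesOf (inv σ) ≡ applyUpTo (position σ) m
valuesOf-inv σ = trans (map-tabulate (λ i → i) _) (tabulate≡applyUpTo (λ i → sym (position-toℕ σ i)))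

valuesOf-Unique : ∀ {m} (π : Permutation′ m) → Unique (valuesOf π)
valuesOf-Unique {m} π = Unique.map⁺ (λ eq → π-injective (toℕ-injective eq)) (Unique.allFin⁺ m)
  where
  π-injective : ∀ {i j} → π ⟨$⟩ʳ i ≡ π ⟨$⟩ʳ j → i ≡ j
  π-injective eq = trans (sym (inverseˡ π)) (trans (cong (π ⟨$⟩ˡ_) eq) (inverseˡ π))

deckOf-sorted : ∀ {m} (σ : Permutation′ m) → AllPairs (_<_ on (position σ ∘ pred)) (deckOf σ)
deckOf-sorted σ =
  AllPairs.map⁺ (AllPairs.tabulate⁺-< (λ {i} {j} → subst₂ _<_ (sym (position-card i)) (sym (position-card j))))
  where
  position-card : ∀ i → position σ (toℕ (σ ⟨$⟩ʳ i)) ≡ toℕ i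
  position-card i = trans (position-toℕ σ (σ ⟨$⟩ʳ i)) (cong toℕ (inverseˡ σ))

∈-deckOf : ∀ {m} (σ : Permutation′ m) {x} → x ∈ deckOf σ ⇔ (0 < x × x ≤ m)
∈-deckOf {m} σ = mk⇔
  (λ x∈ → let (i , _ , x≡) = ∈-map⁻ _ x∈ in
          subst (λ y → 0 < y × y ≤ m) (sym x≡) (s≤s z≤n , toℕ<n (σ ⟨$⟩ʳ i)))
  (λ { (s≤s _ , c<m) →
          subst (_∈ deckOf σ) (cong suc (card-at c<m)) (∈-map⁺ _ (∈-allFin (σ ⟨$⟩ˡ fromℕ< c<m))) })
  where
  card-at : ∀ {c} (c<m : c < m) → toℕ (σ ⟨$⟩ʳ (σ ⟨$⟩ˡ fromℕ< c<m)) ≡ c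
  card-at c<m = trans (cong toℕ (inverseʳ σ)) (toℕ-fromℕ< c<m)

secondPileᵇ : ℕ → ℕ → ℕ → Bool
secondPileᵇ m j x = ⌊ x ≤? j ⌋ ∨ ⌊ m ∸ j <? x ⌋

module Piles {m j : ℕ} (2j≤m : 2 * j ≤ m) where

  t k : ℕ
  t = m ∸ j
  k = m ∸ 2 * j

  j≤m : j ≤ m
  j≤m = ℕ.≤-trans (ℕ.m≤m+n j (j + 0)) 2j≤m

  t+j≡m : t + j ≡ m
  t+j≡m = ℕ.m∸n+n≡m j≤m

  j+k≡t : j + k ≡ t
  j+k≡t = begin
    j + (m ∸ (j + (j + 0))) ≡⟨ cong (λ i → j + (m ∸ (j + i))) (ℕ.+-identityʳ j) ⟩
    j + (m ∸ (j + j))       ≡⟨ cong (_+_ j) (sym (ℕ.∸-+-assoc m j j)) ⟩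
    j + (m ∸ j ∸ j)         ≡⟨ ℕ.m+[n∸m]≡n j≤t ⟩
    m ∸ j                   ∎
    where
    open ≡-Reasoning
    j≤t : j ≤ m ∸ j
    j≤t = ℕ.m+n≤o⇒m≤o∸n j (subst (_≤ m) (cong (_+_ j) (ℕ.+-identityʳ j)) 2j≤m)

  T-secondPileᵇ : ∀ {x} → T (secondPileᵇ m j x) ⇔ (x ≤ j ⊎ t < x)
  T-secondPileᵇ {x} = ⇔.trans T-∨
    (mk⇔ (Sum.map (Equivalence.to (T-⌊⌋ (x ≤? j))) (Equivalence.to (T-⌊⌋ (t <? x))))
         (Sum.map (Equivalence.from (T-⌊⌋ (x ≤? j))) (Equivalence.from (T-⌊⌋ (t <? x)))))

  ∈-pile2 : ∀ {x} → x ∈ pile2 m j ⇔ ((0 < x × x ≤ m) × T (secondPileᵇ m j x))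
  ∈-pile2 {x} = mk⇔ to from
    where
    to : x ∈ pile2 m j → (0 < x × x ≤ m) × T (secondPileᵇ m j x)
    to x∈ with ∈-++⁻ (interval (suc t) j) x∈
    ... | inj₁ x∈bottom = let (t<x , x<) = Equivalence.to (∈-interval (suc t) j) x∈bottom in
      (ℕ.<-≤-trans (s≤s z≤n) t<x , subst (x ≤_) t+j≡m (ℕ.≤-pred x<)) ,
      Equivalence.from T-secondPileᵇ (inj₂ t<x)
    ... | inj₂ x∈top with 0<x , s≤s x≤j ← Equivalence.to (∈-interval 1 j) x∈top =
      (0<x , ℕ.≤-trans x≤j j≤m) , Equivalence.from T-secondPileᵇ (inj₁ x≤j)
    from : (0 < x × x ≤ m) × T (secondPileᵇ m j x) → x ∈ pile2 m j
    from ((0<x , x≤m) , p) with Equivalence.to T-secondPileᵇ p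
    ... | inj₁ x≤j = ∈-++⁺ʳ (interval (suc t) j) (Equivalence.from (∈-interval 1 j) (0<x , s≤s x≤j))
    ... | inj₂ t<x =
      ∈-++⁺ˡ (Equivalence.from (∈-interval (suc t) j) (t<x , s≤s (subst (x ≤_) (sym t+j≡m) x≤m)))

  ∈-pile1 : ∀ {x} → x ∈ pile1 m j ⇔ ((0 < x × x ≤ m) × T (not (secondPileᵇ m j x)))
  ∈-pile1 {x} = mk⇔ to from
    where
    to : x ∈ pile1 m j → (0 < x × x ≤ m) × T (not (secondPileᵇ m j x))
    to x∈ = let (j<x , x<) = Equivalence.to (∈-interval (suc j) k) x∈
                x≤t = subst (x ≤_) j+k≡t (ℕ.≤-pred x<) in
      (ℕ.<-≤-trans (s≤s z≤n) j<x , ℕ.≤-trans x≤t (ℕ.m∸n≤m m j)) ,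
      Equivalence.from T-not (Sum.[ ℕ.<⇒≱ j<x , ℕ.≤⇒≯ x≤t ] ∘ Equivalence.to T-secondPileᵇ)
    from : (0 < x × x ≤ m) × T (not (secondPileᵇ m j x)) → x ∈ pile1 m j
    from ((0<x , x≤m) , ¬p) = Equivalence.from (∈-interval (suc j) k)
      (ℕ.≰⇒> (excluded ∘ inj₁) , s≤s (subst (x ≤_) (sym j+k≡t) (ℕ.≮⇒≥ (excluded ∘ inj₂))))
      where
      excluded : ¬ (x ≤ j ⊎ t < x)
      excluded = Equivalence.to T-not ¬p ∘ Equivalence.from T-secondPileᵇ

-- Admissible vectors

-- admissible w v unfolds to  ⌊ sumℤ v ≟ 0 ⌋ ∧ nonIncreasingᵇ v ∧ endConds w v ∧ descentsKeptᵇ w v.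
nonIncreasingᵇ : List ℤ → Bool
nonIncreasingᵇ v = allB (map (λ p → proj₂ p ≤ᵇ proj₁ p) (consec v))

descentsKeptᵇ : List ℕ → List ℤ → Bool
descentsKeptᵇ w v = allB (map (λ q → if proj₂ (proj₁ q) <ℕᵇ proj₁ (proj₁ q)
                                      then proj₂ (proj₂ q) <ᵇ proj₁ (proj₂ q) else true)
                              (zip (consec w) (consec v)))

endConds-≡ : ∀ w v {w₁ wₘ v₁ vₘ} →
             head w ≡ just w₁ → last w ≡ just wₘ → head v ≡ just v₁ → last v ≡ just vₘ →
             endConds w v ≡ ((v₁ ℤ.- vₘ) ≤ᵇ + 2) ∧ (if w₁ <ℕᵇ wₘ then v₁ <ᵇ (vₘ ℤ.+ + 2) else true)
endConds-≡ w v hw lw hv lv rewrite hw | lw | hv | lv = refl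

T-nonIncreasingᵇ : ∀ v → T (nonIncreasingᵇ v) ⇔ Linked ℤ._≥_ v
T-nonIncreasingᵇ []          = mk⇔ (λ _ → []) (λ _ → tt)
T-nonIncreasingᵇ (x ∷ [])    = mk⇔ (λ _ → [-]) (λ _ → tt)
T-nonIncreasingᵇ (x ∷ y ∷ v) = begin
  T (nonIncreasingᵇ (x ∷ y ∷ v))             ≈⟨ T-∧ ⟩
  (T (y ≤ᵇ x) × T (nonIncreasingᵇ (y ∷ v))) ≈⟨ T-⌊⌋ (y ℤ.≤? x) ×-⇔ T-nonIncreasingᵇ (y ∷ v) ⟩
  (y ℤ.≤ x × Linked ℤ._≥_ (y ∷ v))          ≈⟨ Linked-∷⇔ ⟩
  Linked ℤ._≥_ (x ∷ y ∷ v)                  ∎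
  where open ⇔-Reasoning

T-no-descent : ∀ a b (c : ℤ) → T (if b <ℕᵇ a then c <ᵇ c else true) ⇔ a ≤ b
T-no-descent a b c with b <? a
... | yes b<a = mk⇔ (λ c<c → ⊥-elim (ℤ.<-irrefl refl (toWitness c<c)))
                   (λ a≤b → ⊥-elim (ℕ.<⇒≱ b<a a≤b))
... | no  b≮a = mk⇔ (λ _ → ℕ.≮⇒≥ b≮a) (λ _ → tt)

descentsKept-[] : ∀ w → T (descentsKeptᵇ w [])
descentsKept-[] []          = tt
descentsKept-[] (_ ∷ [])    = tt
descentsKept-[] (_ ∷ _ ∷ _) = tt

-- Inside a constant block of v no descent of w is allowed; the drop of v after the block allows one.
descentsKept-block : ∀ A B c W → All (ℤ._< c) W →
  T (descentsKeptᵇ (A ++ B) (replicate (length A) c ++ W)) ⇔ (Linked _≤_ A × T (descentsKeptᵇ B W))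
descentsKept-block []       B       c W       _         = mk⇔ ([] ,_) proj₂
descentsKept-block (a ∷ []) []      c W       _         = mk⇔ (λ _ → [-] , tt) (λ _ → tt)
descentsKept-block (a ∷ []) (b ∷ B) c []      _         = mk⇔ (λ _ → [-] , descentsKept-[] (b ∷ B)) (λ _ → tt)
descentsKept-block (a ∷ []) (b ∷ B) c (y ∷ W) (y<c ∷ _) = mk⇔
  (λ h → [-] , proj₂ (Equivalence.to T-∧ h))
  (λ (_ , rest) → Equivalence.from T-∧ (T-if-true (b <ℕᵇ a) (fromWitness y<c) , rest))
descentsKept-block (a ∷ a′ ∷ A) B c W W<c = begin
  T (descentsKeptᵇ (a ∷ a′ ∷ A ++ B) (c ∷ replicate (length (a′ ∷ A)) c ++ W))
    ≈⟨ T-∧ ⟩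
  (T (if a′ <ℕᵇ a then c <ᵇ c else true) ×
   T (descentsKeptᵇ (a′ ∷ A ++ B) (replicate (length (a′ ∷ A)) c ++ W)))
    ≈⟨ T-no-descent a a′ c ×-⇔ descentsKept-block (a′ ∷ A) B c W W<c ⟩
  (a ≤ a′ × Linked _≤_ (a′ ∷ A) × T (descentsKeptᵇ B W))
    ≈⟨ mk⇔ (λ (r , l , t) → r ∷ l , t) (λ { (r ∷ l , t) → r , l , t }) ⟩
  (Linked _≤_ (a ∷ a′ ∷ A) × T (descentsKeptᵇ B W))
    ∎
  where open ⇔-Reasoning

descentsKept-replicate : ∀ A c → T (descentsKeptᵇ A (replicate (length A) c)) ⇔ Linked _≤_ A
descentsKept-replicate A c =
  subst₂ (λ A′ v → T (descentsKeptᵇ A′ v) ⇔ Linked _≤_ A) (++-identityʳ A) (++-identityʳ _)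
    (⇔.trans (descentsKept-block A [] c [] []) (mk⇔ proj₁ (_, tt)))

levels : ℕ → ℕ → ℕ → List ℤ
levels a b c = replicate a (+ 1) ++ replicate b (+ 0) ++ replicate c -[1+ 0 ]

staircase : ℕ → ℕ → List ℤ
staircase m j = levels j (m ∸ 2 * j) j

length-levels : ∀ a b c → length (levels a b c) ≡ a + (b + c)
length-levels a b c = trans (length-++ (replicate a (+ 1))) (cong₂ _+_ (length-replicate a)
  (trans (length-++ (replicate b (+ 0))) (cong₂ _+_ (length-replicate b) (length-replicate c))))

sumℤ-++ : ∀ xs ys → sumℤ (xs ++ ys) ≡ sumℤ xs ℤ.+ sumℤ ys
sumℤ-++ []       ys = sym (ℤ.+-identityˡ (sumℤ ys))
sumℤ-++ (x ∷ xs) ys = trans (cong (λ s → x ℤ.+ s) (sumℤ-++ xs ys)) (sym (ℤ.+-assoc x (sumℤ xs) (sumℤ ys)))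

sumℤ-replicate : ∀ n x → sumℤ (replicate n x) ≡ + n ℤ.* x
sumℤ-replicate zero    x = sym (ℤ.*-zeroˡ x)
sumℤ-replicate (suc n) x = trans (cong (λ s → x ℤ.+ s) (sumℤ-replicate n x)) (sym (ℤ.suc-* (+ n) x))

sumℤ-levels : ∀ a b c → sumℤ (levels a b c) ≡ + a ℤ.- + c
sumℤ-levels a b c = begin
  sumℤ (levels a b c)
    ≡⟨ sumℤ-++ (replicate a (+ 1)) _ ⟩
  sumℤ (replicate a (+ 1)) ℤ.+ sumℤ (replicate b (+ 0) ++ replicate c -[1+ 0 ])
    ≡⟨ cong (λ s → sumℤ (replicate a (+ 1)) ℤ.+ s) (sumℤ-++ (replicate b (+ 0)) _) ⟩
  sumℤ (replicate a (+ 1)) ℤ.+ (sumℤ (replicate b (+ 0)) ℤ.+ sumℤ (replicate c -[1+ 0 ]))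
    ≡⟨ cong₂ ℤ._+_ (sumℤ-replicate a _) (cong₂ ℤ._+_ (sumℤ-replicate b _) (sumℤ-replicate c _)) ⟩
  + a ℤ.* + 1 ℤ.+ (+ b ℤ.* + 0 ℤ.+ + c ℤ.* -[1+ 0 ])
    ≡⟨ solve 3 (λ a b c → a :* con (+ 1) :+ (b :* con (+ 0) :+ c :* con -[1+ 0 ]) := a :- c)
               refl (+ a) (+ b) (+ c) ⟩
  + a ℤ.- + c ∎
  where
  open ≡-Reasoning
  open ℤ-Solver using (solve; _:+_; _:*_; _:-_; _:=_; con)

Linked-replicate-++ : ∀ n {x ys} → Linked ℤ._≥_ ys → All (x ℤ.≥_) ys → Linked ℤ._≥_ (replicate n x ++ ys)
Linked-replicate-++ zero          l _  = l
Linked-replicate-++ (suc zero)    l x≥ = All⇒Connected x≥ ∷′ l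
Linked-replicate-++ (suc (suc n)) l x≥ = ℤ.≤-refl ∷ Linked-replicate-++ (suc n) l x≥

levels-nonIncreasing : ∀ a b c → Linked ℤ._≥_ (levels a b c)
levels-nonIncreasing a b c =
  Linked-replicate-++ a (Linked-replicate-++ b minus-ones (All.replicate⁺ c ℤ.-≤+))
    (All.++⁺ (All.replicate⁺ b (ℤ.+≤+ z≤n)) (All.replicate⁺ c ℤ.-≤+))
  where
  minus-ones : Linked ℤ._≥_ (replicate c -[1+ 0 ])
  minus-ones = subst (Linked ℤ._≥_) (++-identityʳ _) (Linked-replicate-++ c [] [])

descentsKept-levels : ∀ X Y Z → T (descentsKeptᵇ (X ++ Y ++ Z) (levels (length X) (length Y) (length Z))) ⇔
                      (Linked _≤_ X × Linked _≤_ Y × Linked _≤_ Z)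
descentsKept-levels X Y Z = begin
  T (descentsKeptᵇ (X ++ Y ++ Z) (levels (length X) (length Y) (length Z)))
    ≈⟨ descentsKept-block X (Y ++ Z) (+ 1) _
         (All.++⁺ (All.replicate⁺ (length Y) (ℤ.+<+ (s≤s z≤n))) (All.replicate⁺ (length Z) ℤ.-<+)) ⟩
  (Linked _≤_ X × T (descentsKeptᵇ (Y ++ Z) (replicate (length Y) (+ 0) ++ replicate (length Z) -[1+ 0 ])))
    ≈⟨ ⇔.refl ×-⇔ descentsKept-block Y Z (+ 0) _ (All.replicate⁺ (length Z) ℤ.-<+) ⟩
  (Linked _≤_ X × Linked _≤_ Y × T (descentsKeptᵇ Z (replicate (length Z) -[1+ 0 ])))
    ≈⟨ ⇔.refl ×-⇔ (⇔.refl ×-⇔ descentsKept-replicate Z -[1+ 0 ]) ⟩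
  (Linked _≤_ X × Linked _≤_ Y × Linked _≤_ Z) ∎
  where open ⇔-Reasoning

endConds-levels : ∀ X Y Z → length X ≡ length Z → X ++ Y ++ Z ≢ [] →
  T (endConds (X ++ Y ++ Z) (levels (length X) (length Y) (length Z))) ⇔ Connected _≤_ (last Z) (head X)
endConds-levels []      []      []      _ w≢[] = ⊥-elim (w≢[] refl)
endConds-levels []      (y ∷ Y) []      _ _ with wₘ , lw ← last-∷ y (Y ++ []) =
  mk⇔ (λ _ → nothing)
      (λ _ → subst T (sym (endConds-≡ (y ∷ Y ++ []) (levels 0 (suc (length Y)) 0) refl lw refl lv))
                   (T-if-true (y <ℕᵇ wₘ) tt))
  where
  lv : last (levels 0 (suc (length Y)) 0) ≡ just (+ 0)
  lv = trans (cong last (++-identityʳ (replicate (suc (length Y)) (+ 0)))) (last-replicate (length Y) (+ 0))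
endConds-levels (x ∷ X) Y       (z ∷ Z) _ _ with zₘ , lz ← last-∷ z Z = begin
  T (endConds ((x ∷ X) ++ Y ++ z ∷ Z) (levels (suc (length X)) (length Y) (suc (length Z))))
    ≡⟨ cong T (endConds-≡ ((x ∷ X) ++ Y ++ z ∷ Z) (levels (suc (length X)) (length Y) (suc (length Z)))
                          refl lw refl lv) ⟩
  T (if x <ℕᵇ zₘ then + 1 <ᵇ + 1 else true)   ≈⟨ T-no-descent zₘ x (+ 1) ⟩
  zₘ ≤ x                                       ≈⟨ ⇔.sym Connected-just⇔ ⟩
  Connected _≤_ (just zₘ) (just x)             ≡⟨ cong (λ l → Connected _≤_ l (just x)) (sym lz) ⟩
  Connected _≤_ (last (z ∷ Z)) (just x)        ∎
  where
  open ⇔-Reasoning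
  lw : last ((x ∷ X) ++ Y ++ z ∷ Z) ≡ just zₘ
  lw = trans (cong last (sym (++-assoc (x ∷ X) Y (z ∷ Z)))) (trans (last-++-∷ ((x ∷ X) ++ Y) z Z) lz)
  lv : last (levels (suc (length X)) (length Y) (suc (length Z))) ≡ just -[1+ 0 ]
  lv = trans (cong last (sym (++-assoc ones zeros _)))
             (trans (last-++-∷ (ones ++ zeros) -[1+ 0 ] (replicate (length Z) -[1+ 0 ]))
                    (last-replicate (length Z) -[1+ 0 ]))
    where
    ones  = replicate (suc (length X)) (+ 1)
    zeros = replicate (length Y) (+ 0)

admissible-levels : ∀ X Y Z → length X ≡ length Z → X ++ Y ++ Z ≢ [] →
  T (admissible (X ++ Y ++ Z) (levels (length X) (length Y) (length Z))) ⇔ (Linked _≤_ (Z ++ X) × Linked _≤_ Y)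
admissible-levels X Y Z |X|≡|Z| w≢[] = begin
  T (admissible w v)
    ≈⟨ T-∧ ⟩
  (T ⌊ sumℤ v ℤ.≟ + 0 ⌋ × T (nonIncreasingᵇ v ∧ endConds w v ∧ descentsKeptᵇ w v))
    ≈⟨ inhabited-×⇔ (fromWitness Σv≡0) ⟩
  T (nonIncreasingᵇ v ∧ endConds w v ∧ descentsKeptᵇ w v)
    ≈⟨ T-∧ ⟩
  (T (nonIncreasingᵇ v) × T (endConds w v ∧ descentsKeptᵇ w v))
    ≈⟨ inhabited-×⇔ (Equivalence.from (T-nonIncreasingᵇ v) v-nonIncreasing) ⟩
  T (endConds w v ∧ descentsKeptᵇ w v)
    ≈⟨ T-∧ ⟩
  (T (endConds w v) × T (descentsKeptᵇ w v))
    ≈⟨ endConds-levels X Y Z |X|≡|Z| w≢[] ×-⇔ descentsKept-levels X Y Z ⟩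
  (Connected _≤_ (last Z) (head X) × Linked _≤_ X × Linked _≤_ Y × Linked _≤_ Z)
    ≈⟨ mk⇔ (λ (c , lX , lY , lZ) → Linked.++⁺ lZ c lX , lY)
           (λ (lZX , lY) → let (lZ , c , lX) = Linked-++⁻ Z lZX in c , lX , lY , lZ) ⟩
  (Linked _≤_ (Z ++ X) × Linked _≤_ Y) ∎
  where
  open ⇔-Reasoning
  w = X ++ Y ++ Z
  v = levels (length X) (length Y) (length Z)
  v-nonIncreasing : Linked ℤ._≥_ v
  v-nonIncreasing = levels-nonIncreasing (length X) (length Y) (length Z)
  Σv≡0 : sumℤ v ≡ + 0
  Σv≡0 = trans (sumℤ-levels (length X) (length Y) (length Z))
               (subst (λ c → + length X ℤ.- + c ≡ + 0) |X|≡|Z| (ℤ.+-inverseʳ (+ length X)))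

-- Every admissible vector is a staircase

endConds-spread : ∀ w v → T (endConds w v) →
                  ∃[ x ] ∃[ l ] (head v ≡ just x × last v ≡ just l × x ℤ.- l ℤ.≤ + 2)
endConds-spread w v h with head v | last v | head w | last w
... | just x  | just l  | just _  | just _  =
  x , l , refl , refl , toWitness (proj₁ (Equivalence.to (T-∧ {⌊ x ℤ.- l ℤ.≤? + 2 ⌋}) h))
... | nothing | _       | _       | _       = ⊥-elim h
... | just _  | nothing | _       | _       = ⊥-elim h
... | just _  | just _  | nothing | _       = ⊥-elim h
... | just _  | just _  | just _  | nothing = ⊥-elim h

admissible⁻ : ∀ w v → T (admissible w v) → sumℤ v ≡ + 0 × Linked ℤ._≥_ v × T (endConds w v)
admissible⁻ w v adm =
  let (Σ≡0 , rest) = Equivalence.to (T-∧ {⌊ sumℤ v ℤ.≟ + 0 ⌋}) adm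
      (ni , rest′) = Equivalence.to (T-∧ {nonIncreasingᵇ v}) rest
  in toWitness Σ≡0 , Equivalence.to (T-nonIncreasingᵇ v) ni ,
     proj₁ (Equivalence.to (T-∧ {endConds w v}) rest′)

Linked-≥-bounds : ∀ {v x l} → Linked ℤ._≥_ v → head v ≡ just x → last v ≡ just l →
                  All (ℤ._≤ x) v × All (l ℤ.≤_) v
Linked-≥-bounds {_ ∷ _} ≥v refl lv =
  Linked.Linked⇒All (λ y≤x z≤y → ℤ.≤-trans z≤y y≤x) ℤ.≤-refl ≥v , above-last ≥v lv
  where
  above-last : ∀ {v l} → Linked ℤ._≥_ v → last v ≡ just l → All (l ℤ.≤_) v
  above-last [-]         refl = ℤ.≤-refl ∷ []
  above-last (y≤x ∷ ≥v) eq with l≤y ∷ rest ← above-last ≥v eq = ℤ.≤-trans l≤y y≤x ∷ l≤y ∷ rest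

sumℤ-nonpositive : ∀ {v} → All (ℤ._≤ + 0) v → sumℤ v ℤ.≤ + 0
sumℤ-nonpositive []           = ℤ.≤-refl
sumℤ-nonpositive (y≤0 ∷ v≤0) = ℤ.+-mono-≤ y≤0 (sumℤ-nonpositive v≤0)

sumℤ-nonnegative : ∀ {v} → All (+ 0 ℤ.≤_) v → + 0 ℤ.≤ sumℤ v
sumℤ-nonnegative []           = ℤ.≤-refl
sumℤ-nonnegative (0≤y ∷ 0≤v) = ℤ.+-mono-≤ 0≤y (sumℤ-nonnegative 0≤v)

nonpositive-+≡0 : ∀ {y s} → y ℤ.≤ + 0 → s ℤ.≤ + 0 → y ℤ.+ s ≡ + 0 → y ≡ + 0 × s ≡ + 0
nonpositive-+≡0 {+ suc _}   (ℤ.+≤+ ()) _ _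
nonpositive-+≡0 {_} {+ suc _} _ (ℤ.+≤+ ()) _
nonpositive-+≡0 {+ 0}       {+ 0}       _ _ _ = refl , refl
nonpositive-+≡0 {+ 0}       { -[1+ _ ]} _ _ ()
nonpositive-+≡0 { -[1+ _ ]} {+ 0}       _ _ ()
nonpositive-+≡0 { -[1+ _ ]} { -[1+ _ ]} _ _ ()

nonnegative-+≡0 : ∀ {y s} → + 0 ℤ.≤ y → + 0 ℤ.≤ s → y ℤ.+ s ≡ + 0 → y ≡ + 0 × s ≡ + 0
nonnegative-+≡0 {+ a} {+ b} _ _ eq =
  cong +_ (ℕ.m+n≡0⇒m≡0 a (ℤ.+-injective eq)) , cong +_ (ℕ.m+n≡0⇒n≡0 a (ℤ.+-injective eq))

sumℤ≡0-nonpositive : ∀ {v} → All (ℤ._≤ + 0) v → sumℤ v ≡ + 0 → All (_≡ + 0) v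
sumℤ≡0-nonpositive []           _   = []
sumℤ≡0-nonpositive (y≤0 ∷ v≤0) Σ≡0 with y≡0 , Σv≡0 ← nonpositive-+≡0 y≤0 (sumℤ-nonpositive v≤0) Σ≡0 =
  y≡0 ∷ sumℤ≡0-nonpositive v≤0 Σv≡0

sumℤ≡0-nonnegative : ∀ {v} → All (+ 0 ℤ.≤_) v → sumℤ v ≡ + 0 → All (_≡ + 0) v
sumℤ≡0-nonnegative []           _   = []
sumℤ≡0-nonnegative (0≤y ∷ 0≤v) Σ≡0 with y≡0 , Σv≡0 ← nonnegative-+≡0 0≤y (sumℤ-nonnegative 0≤v) Σ≡0 =
  y≡0 ∷ sumℤ≡0-nonnegative 0≤v Σv≡0

SignValue : ℤ → Set
SignValue y = -[1+ 0 ] ℤ.≤ y × y ℤ.≤ + 1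

zero-SignValue : ∀ {y} → y ≡ + 0 → SignValue y
zero-SignValue refl = ℤ.-≤+ , ℤ.+≤+ z≤n

straddle≤2⇒±1 : ∀ {x l} → + 0 ℤ.< x → l ℤ.< + 0 → x ℤ.- l ℤ.≤ + 2 → x ≡ + 1 × l ≡ -[1+ 0 ]
straddle≤2⇒±1 {+ 1}           { -[1+ 0 ]}     _ _ _                    = refl , refl
straddle≤2⇒±1 {+ 1}           { -[1+ suc _ ]} _ _ (ℤ.+≤+ (s≤s (s≤s ())))
straddle≤2⇒±1 {+ suc (suc a)} { -[1+ b ]}     _ _ (ℤ.+≤+ (s≤s (s≤s h)))
  with () ← ℕ.≤-trans (ℕ.m≤n+m (suc b) a) h
straddle≤2⇒±1 {+ 0}           (ℤ.+<+ ())
straddle≤2⇒±1 {_}             {+ _}           _ (ℤ.+<+ ())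

-- If x ≤ 0 or 0 ≤ l the zero sum makes v vanish; otherwise x - l ≤ 2 forces x = 1 and l = -1.
signValues : ∀ {v x l} → sumℤ v ≡ + 0 → All (ℤ._≤ x) v → All (l ℤ.≤_) v → x ℤ.- l ℤ.≤ + 2 →
             All SignValue v
signValues {x = x} {l} Σ≡0 ≤x l≤ spread with x ℤ.≤? + 0 | + 0 ℤ.≤? l
... | yes x≤0 | _       =
  All.map zero-SignValue (sumℤ≡0-nonpositive (All.map (λ y≤x → ℤ.≤-trans y≤x x≤0) ≤x) Σ≡0)
... | no _    | yes 0≤l =
  All.map zero-SignValue (sumℤ≡0-nonnegative (All.map (ℤ.≤-trans 0≤l) l≤) Σ≡0)
... | no x≰0  | no 0≰l with refl , refl ← straddle≤2⇒±1 (ℤ.≰⇒> x≰0) (ℤ.≰⇒> 0≰l) spread =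
  All.zip (l≤ , ≤x)

∷-levels : ∀ {y a b c} → SignValue y → Connected ℤ._≥_ (just y) (head (levels a b c)) →
           ∃[ a′ ] ∃[ b′ ] ∃[ c′ ] y ∷ levels a b c ≡ levels a′ b′ c′
∷-levels {+ 1}           {a}     {b}     {c} _ _ = suc a , b , c , refl
∷-levels {+ 0}           {zero}  {b}     {c} _ _ = 0 , suc b , c , refl
∷-levels {+ 0}           {suc _}             _ (just (ℤ.+≤+ ()))
∷-levels { -[1+ 0 ]}     {zero}  {zero}  {c} _ _ = 0 , 0 , suc c , refl
∷-levels { -[1+ 0 ]}     {zero}  {suc _}     _ (just ())
∷-levels { -[1+ 0 ]}     {suc _}             _ (just ())
∷-levels {+ suc (suc _)} (_ , ℤ.+≤+ (s≤s ()))
∷-levels { -[1+ suc _ ]} (ℤ.-≤- () , _)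

levels-of-signs : ∀ {v} → Linked ℤ._≥_ v → All SignValue v → ∃[ a ] ∃[ b ] ∃[ c ] v ≡ levels a b c
levels-of-signs {[]}    _ _ = 0 , 0 , 0 , refl
levels-of-signs {_ ∷ _} ≥v (s ∷ ss) with a , b , c , refl ← levels-of-signs (Linked.tail ≥v) ss =
  ∷-levels {a = a} {b} {c} s (Linked.head′ ≥v)

levels≡staircase : ∀ a b → let n = length (levels a b a) in 2 * a ≤ n × levels a b a ≡ staircase n a
levels≡staircase a b =
  subst (λ n → 2 * a ≤ n × levels a b a ≡ staircase n a) (sym (trans (length-levels a b a) n≡))
        (ℕ.m≤m+n (2 * a) b , cong (λ k → levels a k a) (sym (ℕ.m+n∸m≡n (2 * a) b)))
  where
  open ℕ-Solver using (solve; _:+_; _:*_; _:=_; con)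
  n≡ : a + (b + a) ≡ 2 * a + b
  n≡ = solve 2 (λ a b → a :+ (b :+ a) := con 2 :* a :+ b) refl a b

admissible⇒staircase : ∀ w v → T (admissible w v) → ∃[ j ] (2 * j ≤ length v × v ≡ staircase (length v) j)
admissible⇒staircase w v adm
  with Σ≡0 , ≥v , ends          ← admissible⁻ w v adm
  with x , l , hv , lv , spread ← endConds-spread w v ends
  with ≤x , l≤                  ← Linked-≥-bounds ≥v hv lv
  with a , b , c , refl         ← levels-of-signs ≥v (signValues Σ≡0 ≤x l≤ spread)
  with refl                     ← ℤ.+-injective (ℤ.i-j≡0⇒i≡j (+ a) (+ c) (trans (sym (sumℤ-levels a b c)) Σ≡0))
  = a , levels≡staircase a b

module _ {m : ℕ} (σ : Permutation′ m) {j : ℕ} (2j≤m : 2 * j ≤ m) (0<m : 0 < m) where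
  open Piles {m} {j} 2j≤m

  private
    G = position σ
    X = applyUpTo G j
    Y = applyUpTo (λ i → G (j + i)) k
    Z = applyUpTo (λ i → G (t + i)) j
    p = secondPileᵇ m j
    D = deckOf σ

  values≡blocks : valuesOf (inv σ) ≡ X ++ Y ++ Z
  values≡blocks = begin
    valuesOf (inv σ)          ≡⟨ valuesOf-inv σ ⟩
    applyUpTo G m             ≡⟨ cong (applyUpTo G) (sym t+j≡m) ⟩
    applyUpTo G (t + j)       ≡⟨ applyUpTo-++ G t j ⟩
    applyUpTo G t ++ Z        ≡⟨ cong (λ n → applyUpTo G n ++ Z) (sym j+k≡t) ⟩
    applyUpTo G (j + k) ++ Z  ≡⟨ cong (_++ Z) (applyUpTo-++ G j k) ⟩
    (X ++ Y) ++ Z             ≡⟨ ++-assoc X Y Z ⟩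
    X ++ Y ++ Z               ∎
    where open ≡-Reasoning

  blocks≢[] : X ++ Y ++ Z ≢ []
  blocks≢[] eq = ℕ.<-irrefl (sym m≡0) 0<m
    where
    m≡0 : m ≡ 0
    m≡0 = trans (sym (length-applyUpTo G m))
                (cong length (trans (sym (valuesOf-inv σ)) (trans values≡blocks eq)))

  staircase≡levels : staircase m j ≡ levels (length X) (length Y) (length Z)
  staircase≡levels rewrite length-applyUpTo G j | length-applyUpTo (λ i → G (j + i)) k
                         | length-applyUpTo (λ i → G (t + i)) j = refl

  pile2-positions : map (G ∘ pred) (pile2 m j) ≡ Z ++ X
  pile2-positions = trans (map-++ (G ∘ pred) (interval (suc t) j) (interval 1 j))
                          (cong₂ _++_ (map-interval (G ∘ pred) (suc t) j) (map-interval (G ∘ pred) 1 j))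

  pile1-positions : map (G ∘ pred) (pile1 m j) ≡ Y
  pile1-positions = map-interval (G ∘ pred) (suc j) k

  Linked-<⇔≤-blocks : (Linked _<_ (Z ++ X) × Linked _<_ Y) ⇔ (Linked _≤_ (Z ++ X) × Linked _≤_ Y)
  Linked-<⇔≤-blocks with uZX , uY ← Unique-rotate X Y Z (subst Unique values≡blocks (valuesOf-Unique (inv σ))) =
    mk⇔ (λ (l₁ , l₂) → Linked.map ℕ.<⇒≤ l₁ , Linked.map ℕ.<⇒≤ l₂)
        (λ (l₁ , l₂) → Linked-≤⇒< uZX l₁ , Linked-≤⇒< uY l₂)

  admissible⇔sorted-piles : T (admissible (valuesOf (inv σ)) (staircase m j)) ⇔
                            (filterᵇ p D ≡ pile2 m j × filterᵇ (not ∘ p) D ≡ pile1 m j)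
  admissible⇔sorted-piles = begin
    T (admissible (valuesOf (inv σ)) (staircase m j))
      ≡⟨ cong₂ (λ w v → T (admissible w v)) values≡blocks staircase≡levels ⟩
    T (admissible (X ++ Y ++ Z) (levels (length X) (length Y) (length Z)))
      ≈⟨ admissible-levels X Y Z (trans (length-applyUpTo G j) (sym (length-applyUpTo _ j))) blocks≢[] ⟩
    (Linked _≤_ (Z ++ X) × Linked _≤_ Y)
      ≈⟨ ⇔.sym Linked-<⇔≤-blocks ⟩
    (Linked _<_ (Z ++ X) × Linked _<_ Y)
      ≡⟨ cong₂ (λ P₂ P₁ → Linked _<_ P₂ × Linked _<_ P₁) (sym pile2-positions) (sym pile1-positions) ⟩
    (Linked _<_ (map (G ∘ pred) (pile2 m j)) × Linked _<_ (map (G ∘ pred) (pile1 m j)))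
      ≈⟨ Linked-<-map⇔ (G ∘ pred) ×-⇔ Linked-<-map⇔ (G ∘ pred) ⟩
    (AllPairs (_<_ on (G ∘ pred)) (pile2 m j) × AllPairs (_<_ on (G ∘ pred)) (pile1 m j))
      ≈⟨ ⇔.sym (filterᵇ-≡⇔AllPairs ℕ.<-asym p (deckOf-sorted σ) (in-deck ∈-pile2)
           ×-⇔ filterᵇ-≡⇔AllPairs ℕ.<-asym (not ∘ p) (deckOf-sorted σ) (in-deck ∈-pile1)) ⟩
    (filterᵇ p D ≡ pile2 m j × filterᵇ (not ∘ p) D ≡ pile1 m j) ∎
    where
    open ⇔-Reasoning
    in-deck : ∀ {P : Set} {x} {B : List ℕ} → x ∈ B ⇔ ((0 < x × x ≤ m) × P) → x ∈ B ⇔ (x ∈ D × P)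
    in-deck ∈B = ⇔.trans ∈B (⇔.sym (∈-deckOf σ) ×-⇔ ⇔.refl)

  interleavings≡indicator : interleavingsGiving j σ ≡ indicator (admissible (valuesOf (inv σ)) (staircase m j))
  interleavings≡indicator =
    subst₂ (λ c n → count (interleavesᵇ (pile1 m j) (pile2 m j) D c) (boolLists n) ≡
                    indicator (admissible (valuesOf (inv σ)) (staircase m j)))
           |pile2| |D| (count-interleavings {p = p} {D = D} pile1-¬p pile2-p |piles| admissible⇔sorted-piles)
    where
    pile1-¬p : All (T ∘ not ∘ p) (pile1 m j)
    pile1-¬p = All.tabulate (proj₂ ∘ Equivalence.to ∈-pile1)
    pile2-p : All (T ∘ p) (pile2 m j)
    pile2-p = All.tabulate (proj₂ ∘ Equivalence.to ∈-pile2)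
    |pile2| : length (pile2 m j) ≡ 2 * j
    |pile2| = trans (length-++ (interval (suc t) j))
                    (cong₂ _+_ (length-interval (suc t) j) (trans (length-interval 1 j) (sym (ℕ.+-identityʳ j))))
    |D| : length D ≡ m
    |D| = trans (length-map _ (allFin m)) (length-tabulate (λ i → i))
    |piles| : length (pile1 m j) + length (pile2 m j) ≡ length D
    |piles| = trans (cong₂ _+_ (length-interval (suc j) k) |pile2|) (trans (ℕ.m∸n+n≡m 2j≤m) (sym |D|))

-- Summing over j

leadingOnes : List ℤ → ℕ
leadingOnes (+ 1 ∷ v) = suc (leadingOnes v)
leadingOnes _         = 0

leadingOnes-levels : ∀ a b c → leadingOnes (levels a b c) ≡ a
leadingOnes-levels (suc a) b       c       = cong suc (leadingOnes-levels a b c)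
leadingOnes-levels zero    (suc b) c       = refl
leadingOnes-levels zero    zero    (suc c) = refl
leadingOnes-levels zero    zero    zero    = refl

staircase-injective : ∀ m {j j′} → staircase m j ≡ staircase m j′ → j ≡ j′
staircase-injective m {j} {j′} eq =
  trans (sym (leadingOnes-levels j _ j)) (trans (cong leadingOnes eq) (leadingOnes-levels j′ _ j′))

length-staircase : ∀ {m j} → 2 * j ≤ m → length (staircase m j) ≡ m
length-staircase {m} {j} 2j≤m = begin
  length (levels j (m ∸ 2 * j) j)  ≡⟨ length-levels j (m ∸ 2 * j) j ⟩
  j + (m ∸ 2 * j + j)              ≡⟨ solve 2 (λ j k → j :+ (k :+ j) := k :+ con 2 :* j) refl j (m ∸ 2 * j) ⟩
  m ∸ 2 * j + 2 * j                ≡⟨ ℕ.m∸n+n≡m 2j≤m ⟩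
  m                                ∎
  where
  open ≡-Reasoning
  open ℕ-Solver using (solve; _:+_; _:*_; _:=_; con)

digits : List ℤ
digits = -[1+ 1 ] ∷ -[1+ 0 ] ∷ + 0 ∷ + 1 ∷ + 2 ∷ []

smallVecs≡words : ∀ k → smallVecs k ≡ words digits k
smallVecs≡words zero    = refl
smallVecs≡words (suc k) = cong (cartesianProductWith _∷_ digits) (smallVecs≡words k)

smallVecs-Unique : ∀ m → Unique (smallVecs m)
smallVecs-Unique m = subst Unique (sym (smallVecs≡words m)) (words-Unique digits-Unique m)
  where
  digits-Unique : Unique digits
  digits-Unique = ((λ ()) ∷ (λ ()) ∷ (λ ()) ∷ (λ ()) ∷ []) ∷ ((λ ()) ∷ (λ ()) ∷ (λ ()) ∷ []) ∷
                  ((λ ()) ∷ (λ ()) ∷ []) ∷ ((λ ()) ∷ []) ∷ [] ∷ []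

∈-smallVecs⁻ : ∀ {m v} → v ∈ smallVecs m → length v ≡ m
∈-smallVecs⁻ {m} v∈ = ∈-words⁻ digits m (subst (_ ∈_) (smallVecs≡words m) v∈)

staircase∈smallVecs : ∀ {m j} → 2 * j ≤ m → staircase m j ∈ smallVecs m
staircase∈smallVecs {m} {j} 2j≤m = subst (λ k → staircase m j ∈ smallVecs k) (length-staircase {m} {j} 2j≤m)
  (subst (staircase m j ∈_) (sym (smallVecs≡words (length (staircase m j)))) (∈-words⁺ levels∈digits))
  where
  levels∈digits : All (_∈ digits) (staircase m j)
  levels∈digits = All.++⁺ (All.replicate⁺ j (there (there (there (here refl))))) (All.++⁺
                    (All.replicate⁺ (m ∸ 2 * j) (there (there (here refl)))) (All.replicate⁺ j (there (here refl))))

module ParameterRange {m n : ℕ} (2n≤m : 2 * n ≤ m) (m≤2n+1 : m ≤ suc (2 * n)) where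

  2j≤m : ∀ {j} → j < suc n → 2 * j ≤ m
  2j≤m (s≤s j≤n) = ℕ.≤-trans (ℕ.*-monoʳ-≤ 2 j≤n) 2n≤m

  j<1+n : ∀ {j} → 2 * j ≤ m → j < suc n
  j<1+n {j} 2j≤m = ℕ.*-cancelˡ-< 2 j (suc n)
    (ℕ.≤-<-trans 2j≤m (ℕ.<-≤-trans (s≤s m≤2n+1) (ℕ.≤-reflexive (sym (ℕ.*-suc 2 n)))))

module _ {m n : ℕ} (σ : Permutation′ m) (0<m : 0 < m) (2n≤m : 2 * n ≤ m) (m≤2n+1 : m ≤ suc (2 * n)) where
  open ParameterRange {m} {n} 2n≤m m≤2n+1

  private
    w = valuesOf (inv σ)

  x2Count≡count-staircases : x2Count (inv σ) ≡ count (λ j → admissible w (staircase m j)) (upTo (suc n))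
  x2Count≡count-staircases = begin
    count (admissible w) (smallVecs m)
      ≡⟨ count-cong-Unique (admissible w) (smallVecs-Unique m)
           (Unique.map⁺ (staircase-injective m) (Unique.upTo⁺ (suc n))) same ⟩
    count (admissible w) (map (staircase m) (upTo (suc n)))
      ≡⟨ count-map (admissible w) (staircase m) (upTo (suc n)) ⟩
    count (λ j → admissible w (staircase m j)) (upTo (suc n)) ∎
    where
    open ≡-Reasoning
    same : ∀ {v} → T (admissible w v) → v ∈ smallVecs m ⇔ v ∈ map (staircase m) (upTo (suc n))
    same {v} adm = mk⇔
      (λ v∈ → let |v|≡m = ∈-smallVecs⁻ v∈
                  (j , 2j≤|v| , v≡) = admissible⇒staircase w v adm in
              subst (_∈ map (staircase m) (upTo (suc n))) (sym (subst (λ k → v ≡ staircase k j) |v|≡m v≡))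
                    (∈-map⁺ (staircase m) (∈-upTo⁺ (j<1+n {j} (subst (2 * j ≤_) |v|≡m 2j≤|v|)))))
      (λ v∈ → let (j , j∈ , v≡) = ∈-map⁻ (staircase m) v∈ in
              subst (_∈ smallVecs m) (sym v≡) (staircase∈smallVecs {m} {j} (2j≤m (∈-upTo⁻ j∈))))

  sum-interleavings≡x2Count : sum (map (λ j → interleavingsGiving j σ) (upTo (suc n))) ≡ x2Count (inv σ)
  sum-interleavings≡x2Count = begin
    sum (map (λ j → interleavingsGiving j σ) (upTo (suc n)))
      ≡⟨ cong sum (map-cong-local (All.tabulate (λ j∈ → interleavings≡indicator σ (2j≤m (∈-upTo⁻ j∈)) 0<m))) ⟩
    sum (map (indicator ∘ (λ j → admissible w (staircase m j))) (upTo (suc n)))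
      ≡⟨ sum-indicator (λ j → admissible w (staircase m j)) (upTo (suc n)) ⟩
    count (λ j → admissible w (staircase m j)) (upTo (suc n))
      ≡⟨ sym x2Count≡count-staircases ⟩
    x2Count (inv σ) ∎
    where open ≡-Reasoning

nCk>0 : ∀ {n k} → k ≤ n → 0 < n C k
nCk>0 {n}     {zero}  _         = s≤s z≤n
nCk>0 {suc n} {suc k} (s≤s k≤n) =
  subst (0 <_) (nCk+nC[k+1]≡[n+1]C[k+1] n k) (ℕ.<-≤-trans (nCk>0 k≤n) (ℕ.m≤m+n (n C k) (n C suc k)))

toℚᵘ-/' : ∀ a d → toℚᵘ (a /' suc d) ℚᵘ.≃ mkℚᵘ (+ a) d
toℚᵘ-/' a d = ℚ.toℚᵘ-fromℚᵘ (mkℚᵘ (+ a) d)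

/'-+ : ∀ a b d → a /' suc d ℚ.+ b /' suc d ≡ (a + b) /' suc d
/'-+ a b d = ℚ.toℚᵘ-injective (begin
  toℚᵘ (a /' suc d ℚ.+ b /' suc d)             ≈⟨ ℚ.toℚᵘ-homo-+ (a /' suc d) (b /' suc d) ⟩
  toℚᵘ (a /' suc d) ℚᵘ.+ toℚᵘ (b /' suc d)     ≈⟨ ℚᵘ.+-cong (toℚᵘ-/' a d) (toℚᵘ-/' b d) ⟩
  mkℚᵘ (+ a) d ℚᵘ.+ mkℚᵘ (+ b) d               ≈⟨ *≡* same-denominator ⟩
  mkℚᵘ (+ (a + b)) d                            ≈⟨ ℚᵘ.≃-sym (toℚᵘ-/' (a + b) d) ⟩
  toℚᵘ ((a + b) /' suc d)                      ∎)
  where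
  open ℚᵘ.≃-Reasoning
  open ℤ-Solver using (solve; _:+_; _:*_; _:=_)
  same-denominator : (+ a ℤ.* + suc d ℤ.+ + b ℤ.* + suc d) ℤ.* + suc d ≡ + (a + b) ℤ.* + (suc d * suc d)
  same-denominator rewrite ℤ.pos-* (suc d) (suc d) | ℤ.pos-+ a b =
    solve 3 (λ a b d → (a :* d :+ b :* d) :* d := (a :+ b) :* (d :* d)) refl (+ a) (+ b) (+ suc d)

/'-cancel : ∀ {c} k d → 0 < c → (c /' suc d) ℚ.* (k /' c) ≡ k /' suc d
/'-cancel {suc c} k d _ = ℚ.toℚᵘ-injective (begin
  toℚᵘ ((suc c /' suc d) ℚ.* (k /' suc c))       ≈⟨ ℚ.toℚᵘ-homo-* (suc c /' suc d) (k /' suc c) ⟩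
  toℚᵘ (suc c /' suc d) ℚᵘ.* toℚᵘ (k /' suc c)   ≈⟨ ℚᵘ.*-cong (toℚᵘ-/' (suc c) d) (toℚᵘ-/' k c) ⟩
  mkℚᵘ (+ suc c) d ℚᵘ.* mkℚᵘ (+ k) c             ≈⟨ *≡* cancelled ⟩
  mkℚᵘ (+ k) d                                    ≈⟨ ℚᵘ.≃-sym (toℚᵘ-/' k d) ⟩
  toℚᵘ (k /' suc d)                               ∎)
  where
  open ℚᵘ.≃-Reasoning
  open ℤ-Solver using (solve; _:*_; _:=_)
  cancelled : (+ suc c ℤ.* + k) ℤ.* + suc d ≡ + k ℤ.* + (suc d * suc c)
  cancelled rewrite ℤ.pos-* (suc d) (suc c) =
    solve 3 (λ c k d → (c :* k) :* d := k :* (d :* c)) refl (+ suc c) (+ k) (+ suc d)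

Σℚ : (ℕ → ℚ) → List ℕ → ℚ
Σℚ f = foldr (λ j acc → f j ℚ.+ acc) 0ℚ

Σℚ-cong : ∀ {f g : ℕ → ℚ} {xs} → All (λ j → f j ≡ g j) xs → Σℚ f xs ≡ Σℚ g xs
Σℚ-cong []         = refl
Σℚ-cong (eq ∷ eqs) = cong₂ ℚ._+_ eq (Σℚ-cong eqs)

Σℚ-/' : ∀ (k : ℕ → ℕ) d xs → Σℚ (λ j → k j /' suc d) xs ≡ sum (map k xs) /' suc d
Σℚ-/' k d []       = ℚ.toℚᵘ-injective (ℚᵘ.≃-trans (*≡* refl) (ℚᵘ.≃-sym (toℚᵘ-/' 0 d)))
Σℚ-/' k d (j ∷ xs) = trans (cong (k j /' suc d ℚ.+_) (Σℚ-/' k d xs)) (/'-+ (k j) (sum (map k xs)) d)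

Σℚ-weighted : ∀ (c k : ℕ → ℕ) D xs → 0 < D → All (λ j → 0 < c j) xs →
              Σℚ (λ j → (c j /' D) ℚ.* (k j /' c j)) xs ≡ sum (map k xs) /' D
Σℚ-weighted c k (suc d) xs _ c>0 = trans (Σℚ-cong (All.map (λ {j} → /'-cancel (k j) d) c>0)) (Σℚ-/' k d xs)

shuffleProb≡x₂ : ∀ {m} n (σ : Permutation′ m) → 0 < m → 2 * n ≤ m → m ≤ suc (2 * n) →
                 shuffleProb m n σ ≡ x₂ (inv σ)
shuffleProb≡x₂ {m} n σ 0<m 2n≤m m≤2n+1 = begin
  shuffleProb m n σ
    ≡⟨ Σℚ-weighted (λ j → m C (2 * j)) (λ j → interleavingsGiving j σ) (2 ^ (m ∸ 1)) (upTo (suc n))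
                   (ℕ.m^n>0 2 (m ∸ 1)) (All.tabulate (λ j∈ → nCk>0 (2j≤m (∈-upTo⁻ j∈)))) ⟩
  sum (map (λ j → interleavingsGiving j σ) (upTo (suc n))) /' (2 ^ (m ∸ 1))
    ≡⟨ cong (_/' (2 ^ (m ∸ 1))) (sum-interleavings≡x2Count {n = n} σ 0<m 2n≤m m≤2n+1) ⟩
  x₂ (inv σ) ∎
  where
  open ≡-Reasoning
  open ParameterRange {m} {n} 2n≤m m≤2n+1

theorem3 : ((n : ℕ) → 1 ≤ n → (σ : Permutation′ (2 * n)) →
              shuffleProb (2 * n) n σ ≡ x₂ (inv σ))
           × ((n : ℕ) → (σ : Permutation′ (suc (2 * n))) →
              shuffleProb (suc (2 * n)) n σ ≡ x₂ (inv σ))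
theorem3 = even , odd
  where
  even : (n : ℕ) → 1 ≤ n → (σ : Permutation′ (2 * n)) → shuffleProb (2 * n) n σ ≡ x₂ (inv σ)
  even (suc n) _ σ = shuffleProb≡x₂ (suc n) σ (s≤s z≤n) ℕ.≤-refl (ℕ.n≤1+n _)
  odd : (n : ℕ) → (σ : Permutation′ (suc (2 * n))) → shuffleProb (suc (2 * n)) n σ ≡ x₂ (inv σ)
  odd n σ = shuffleProb≡x₂ n σ (s≤s z≤n) (ℕ.n≤1+n _) ℕ.≤-refl
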